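{- Let $L$ be a list-assignment for a graph $G$ such that $\deg_G(v) +2 \leq 3 |L(v)|$ for each vertex $v$ of $G$, and let $\phi$ be an $L$-colouring of $G$ that minimises the number of monochromatic edges. Then $\phi$ has defect $2$. Moreover, for each vertex $v$ with defect $2$ under $\phi$, there is a colour $\beta_v\in L(v)\setminus\{\phi(v)\}$ such that at most two neighbours of $v$ are coloured $\beta_v$ under $\phi$.
   Context: Graphs are finite and simple. A list-assignment $L$ assigns a set $L(v)$ of colours to each vertex $v$; an $L$-colouring colours each $v$ with a colour from $L(v)$. An edge is monochromatic if its endpoints have the same colour; the monochromatic subgraph is the spanning subgraph of monochromatic edges. The defect of a vertex is its degree in the monochromatic subgraph; a colouring has defect $d$ if every vertex has defect at most $d$. -}

module Defs where

open import Data.Nat using (ℕ; _≤_; _+_; _*_; _<_)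
open import Data.Nat.Properties using (_≟_)
open import Data.Bool using (Bool; true; false; _∧_)
open import Data.Fin using (Fin)
open import Data.Fin.Properties renaming (_≟_ to _≟ᶠ_)
open import Data.List using (List; length; filter; allFin; cartesianProduct)
open import Data.List.Membership.Propositional using (_∈_)
open import Data.List.Relation.Unary.Unique.Propositional using (Unique)
open import Data.Product using (_×_; _,_; proj₁; proj₂)
open import Relation.Binary.PropositionalEquality using (_≡_)
open import Relation.Nullary using (¬_; does)

record Graph (n : ℕ) : Set where
  field
    adj   : Fin n → Fin n → Bool
    sym   : ∀ u v → adj u v ≡ adj v u
    irrefl : ∀ v → adj v v ≡ false
open Graph public

Colour : Set
Colour = ℕ

-- A list-assignment: a finite set of colours for each vertex,
-- represented by a duplicate-free list.
record ListAssignment (n : ℕ) : Set where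
  field
    lst    : Fin n → List Colour
    unique : ∀ v → Unique (lst v)
open ListAssignment public

∣L∣ : ∀ {n} → ListAssignment n → Fin n → ℕ
∣L∣ L v = length (lst L v)

Colouring : ℕ → Set
Colouring n = Fin n → Colour

IsLColouring : ∀ {n} → ListAssignment n → Colouring n → Set
IsLColouring L φ = ∀ v → φ v ∈ lst L v

neighbours : ∀ {n} → Graph n → Fin n → List (Fin n)
neighbours G v = filter (λ u → adj G v u Data.Bool.≟ true) (allFin _)

deg : ∀ {n} → Graph n → Fin n → ℕ
deg G v = length (neighbours G v)

nbrsColoured : ∀ {n} → Graph n → Colouring n → Fin n → Colour → ℕ
nbrsColoured G φ v c = length (filter (λ u → φ u ≟ c) (neighbours G v))

defect : ∀ {n} → Graph n → Colouring n → Fin n → ℕ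
defect G φ v = nbrsColoured G φ v (φ v)

HasDefect : ∀ {n} → Graph n → Colouring n → ℕ → Set
HasDefect G φ d = ∀ v → defect G φ v ≤ d

monoEdges : ∀ {n} → Graph n → Colouring n → ℕ
monoEdges {n} G φ =
  length (filter (λ p → Data.Fin._<?_ (proj₁ p) (proj₂ p))
          (filter (λ p → φ (proj₁ p) ≟ φ (proj₂ p))
           (filter (λ p → adj G (proj₁ p) (proj₂ p) Data.Bool.≟ true)
            (cartesianProduct (allFin n) (allFin n)))))

MinimisesMono : ∀ {n} → Graph n → ListAssignment n → Colouring n → Set
MinimisesMono G L φ =
  IsLColouring L φ × (∀ ψ → IsLColouring L ψ → monoEdges G φ ≤ monoEdges G ψ)

-- Recolouring v from φ(v) to c changes the number of monochromatic edges by
-- n(c) − n(φ(v)), where n(c) is the number of neighbours of v coloured c, since only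
-- the edges at v are affected. Hence at a minimiser the defect n(φ(v)) is at most
-- n(c) for every c ∈ L(v). The classes counted by n(c), c ∈ L(v), are disjoint sets
-- of neighbours, so if n(c) + [c = φ(v)] ≥ 3 for every c ∈ L(v), then
-- 3|L(v)| ≤ deg(v) + 1, contradicting deg(v) + 2 ≤ 3|L(v)|. A vertex of defect at
-- least 3, or of defect 2 with n(c) ≥ 3 for all c ≠ φ(v), would be such a vertex.
module Submission where

open import Defs hiding (sym)
open import Data.Bool using (true; false; if_then_else_)
import Data.Bool as Bool
open import Data.Empty using (⊥-elim)
open import Data.Fin using (Fin; _<_; _<?_)
open import Data.Fin.Properties using (<-asym; <-cmp) renaming (_≟_ to _≟ᶠ_)
open import Data.List using (List; []; _∷_; length; filter; allFin; cartesianProduct; map; _++_)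
open import Data.List.Membership.Propositional using (_∈_; find; lose)
open import Data.List.Membership.Propositional.Properties using (∈-allFin; ∈-filter⁻)
open import Data.List.Relation.Unary.All using (All; []; _∷_)
import Data.List.Relation.Unary.All as All
open import Data.List.Relation.Unary.Any using (here; there; any?)
open import Data.List.Relation.Unary.AllPairs using ([]; _∷_)
open import Data.List.Relation.Unary.Unique.Propositional using (Unique)
open import Data.List.Relation.Unary.Unique.Propositional.Properties using (allFin⁺)
open import Data.Nat using (ℕ; suc; _≤_; _+_; _*_; z≤n; s≤s; _≤?_)
open import Data.Nat.Properties
  using (_≟_; +-commutativeSemigroup; *-zeroʳ; *-suc; +-assoc; +-identityʳ; +-cancelˡ-≤;
         +-mono-≤; +-monoˡ-≤; ≤-trans; ≤-reflexive;
         ≰⇒>; m≤m+n; module ≤-Reasoning)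
open import Algebra.Properties.CommutativeSemigroup +-commutativeSemigroup
  using (interchange; xy∙z≈xz∙y)
open import Data.Product using (_×_; Σ; _,_; proj₁; proj₂)
open import Data.Vec.Functional using (updateAt)
open import Data.Vec.Functional.Properties using (updateAt-updates; updateAt-minimal)
open import Level using (Level)
open import Function using (_∘_; const)
open import Function.Bundles using (mk⇔)
open import Relation.Binary using (DecidableEquality; tri<; tri≈; tri>)
open import Relation.Binary.PropositionalEquality
  using (_≡_; _≢_; refl; sym; trans; cong; cong₂; subst; module ≡-Reasoning)
open import Relation.Nullary using (Dec; yes; no; does; ¬_; ¬?)
open import Relation.Nullary.Decidable using (does-⇔; _×-dec_)
open import Relation.Unary using (Decidable)

private
  variable
    a b p : Level
    A : Set a
    B : Set b

𝟙 : {P : Set p} → Dec P → ℕ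
𝟙 P? = if does P? then 1 else 0

∑ : (A → ℕ) → List A → ℕ
∑ f []       = 0
∑ f (x ∷ xs) = f x + ∑ f xs

module _ {f g : A → ℕ} where

  ∑-cong : ∀ xs → (∀ {x} → x ∈ xs → f x ≡ g x) → ∑ f xs ≡ ∑ g xs
  ∑-cong []       eq = refl
  ∑-cong (x ∷ xs) eq = cong₂ _+_ (eq (here refl)) (∑-cong xs (eq ∘ there))

  ∑-mono : ∀ xs → (∀ {x} → x ∈ xs → f x ≤ g x) → ∑ f xs ≤ ∑ g xs
  ∑-mono []       le = z≤n
  ∑-mono (x ∷ xs) le = +-mono-≤ (le (here refl)) (∑-mono xs (le ∘ there))

  ∑-+ : ∀ xs → ∑ (λ x → f x + g x) xs ≡ ∑ f xs + ∑ g xs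
  ∑-+ []       = refl
  ∑-+ (x ∷ xs) = trans (cong (f x + g x +_) (∑-+ xs)) (interchange (f x) (g x) _ _)

∑-const : ∀ k (xs : List A) → ∑ (const k) xs ≡ k * length xs
∑-const k []       = sym (*-zeroʳ k)
∑-const k (x ∷ xs) = trans (cong (k +_) (∑-const k xs)) (sym (*-suc k (length xs)))

∑-if : ∀ b (f : A → ℕ) xs →
  ∑ (λ x → if b then f x else 0) xs ≡ (if b then ∑ f xs else 0)
∑-if true  f xs = refl
∑-if false f xs = ∑-const 0 xs

∑-++ : ∀ (f : A → ℕ) xs ys → ∑ f (xs ++ ys) ≡ ∑ f xs + ∑ f ys
∑-++ f []       ys = refl
∑-++ f (x ∷ xs) ys = trans (cong (f x +_) (∑-++ f xs ys)) (sym (+-assoc (f x) _ _))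

∑-map : ∀ (f : B → ℕ) (g : A → B) xs → ∑ f (map g xs) ≡ ∑ (f ∘ g) xs
∑-map f g []       = refl
∑-map f g (x ∷ xs) = cong (f (g x) +_) (∑-map f g xs)

∑-cartesianProduct : ∀ (f : A × B → ℕ) xs ys →
  ∑ f (cartesianProduct xs ys) ≡ ∑ (λ x → ∑ (λ y → f (x , y)) ys) xs
∑-cartesianProduct f []       ys = refl
∑-cartesianProduct f (x ∷ xs) ys = trans (∑-++ f (map (x ,_) ys) _)
  (cong₂ _+_ (∑-map f (x ,_) ys) (∑-cartesianProduct f xs ys))

∑-filter : ∀ {P : A → Set p} (P? : Decidable P) (f : A → ℕ) xs →
  ∑ f (filter P? xs) ≡ ∑ (λ x → if does (P? x) then f x else 0) xs
∑-filter P? f []       = refl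
∑-filter P? f (x ∷ xs) with does (P? x)
... | true  = cong (f x +_) (∑-filter P? f xs)
... | false = ∑-filter P? f xs

length-filter≡∑ : ∀ {P : A → Set p} (P? : Decidable P) xs →
  length (filter P? xs) ≡ ∑ (λ x → 𝟙 (P? x)) xs
length-filter≡∑ P? xs = trans (length≡∑ (filter P? xs)) (∑-filter P? (const 1) xs)
  where
  length≡∑ : (xs : List A) → length xs ≡ ∑ (const 1) xs
  length≡∑ []       = refl
  length≡∑ (x ∷ xs) = cong suc (length≡∑ xs)

module _ {A : Set a} (_≟ᴬ_ : DecidableEquality A) (g : A → ℕ) (x : A) where

  ∑-select-absent : ∀ {ys} → All (x ≢_) ys →
    ∑ (λ y → if does (x ≟ᴬ y) then g y else 0) ys ≡ 0
  ∑-select-absent []           = refl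
  ∑-select-absent {y ∷ ys} (x≢y ∷ x∉ys) with x ≟ᴬ y
  ... | yes x≡y = ⊥-elim (x≢y x≡y)
  ... | no  _   = ∑-select-absent x∉ys

  ∑-select : ∀ {ys} → x ∈ ys → Unique ys →
    ∑ (λ y → if does (x ≟ᴬ y) then g y else 0) ys ≡ g x
  ∑-select {y ∷ ys} (here refl) (y∉ys ∷ _) with x ≟ᴬ y
  ... | yes _   = trans (cong (g x +_) (∑-select-absent y∉ys)) (+-identityʳ (g x))
  ... | no  x≢x = ⊥-elim (x≢x refl)
  ∑-select {y ∷ ys} (there x∈ys) (y∉ys ∷ ys!) with x ≟ᴬ y
  ... | yes refl = ⊥-elim (All.lookup y∉ys x∈ys refl)
  ... | no  _    = ∑-select x∈ys ys!

  ∑-select-≤ : ∀ {ys} → Unique ys →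
    ∑ (λ y → if does (x ≟ᴬ y) then g y else 0) ys ≤ g x
  ∑-select-≤ {[]}     []           = z≤n
  ∑-select-≤ {y ∷ ys} (y∉ys ∷ ys!) with x ≟ᴬ y
  ... | yes refl = ≤-reflexive (trans (cong (g x +_) (∑-select-absent y∉ys)) (+-identityʳ (g x)))
  ... | no  _    = ∑-select-≤ ys!

∑-count≤length : ∀ (f : A → ℕ) us {cs} → Unique cs →
  ∑ (λ c → length (filter (λ u → f u ≟ c) us)) cs ≤ length us
∑-count≤length f us {cs} cs! =
  ≤-trans (≤-reflexive (∑-cong cs (λ {c} _ → length-filter≡∑ (λ u → f u ≟ c) us)))
          (count us)
  where
  open ≤-Reasoning
  count : ∀ us → ∑ (λ c → ∑ (λ u → 𝟙 (f u ≟ c)) us) cs ≤ length us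
  count []       = ≤-reflexive (∑-const 0 cs)
  count (u ∷ us) = begin
    ∑ (λ c → 𝟙 (f u ≟ c) + ∑ (λ u → 𝟙 (f u ≟ c)) us) cs
      ≡⟨ ∑-+ cs ⟩
    ∑ (λ c → 𝟙 (f u ≟ c)) cs + ∑ (λ c → ∑ (λ u → 𝟙 (f u ≟ c)) us) cs
      ≤⟨ +-mono-≤ (∑-select-≤ _≟_ (const 1) (f u) cs!) (count us) ⟩
    1 + length us ∎

<?-+->?≡1 : ∀ {n} {u v : Fin n} → u ≢ v →
  𝟙 (u <? v) + 𝟙 (v <? u) ≡ 1
<?-+->?≡1 {u = u} {v} u≢v = exactlyOne (u <? v) (v <? u)
  where
  exactlyOne : (u<v? : Dec (u < v)) (v<u? : Dec (v < u)) →
    𝟙 u<v? + 𝟙 v<u? ≡ 1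
  exactlyOne (yes u<v) (yes v<u) = ⊥-elim (<-asym u<v v<u)
  exactlyOne (yes _)   (no  _)   = refl
  exactlyOne (no  _)   (yes _)   = refl
  exactlyOne (no  u≮v) (no  v≮u) with <-cmp u v
  ... | tri< u<v _   _   = ⊥-elim (u≮v u<v)
  ... | tri≈ _   u≡v _   = ⊥-elim (u≢v u≡v)
  ... | tri> _   _   v<u = ⊥-elim (v≮u v<u)

∑∑ : ∀ {n} → (Fin n → Fin n → ℕ) → ℕ
∑∑ {n} t = ∑ (λ x → ∑ (t x) (allFin n)) (allFin n)

module _ {n} (v : Fin n) where

  private
    all : List (Fin n)
    all = allFin n

  avoiding meeting : (Fin n → Fin n → ℕ) → Fin n → Fin n → ℕ
  avoiding t x y = if does (v ≟ᶠ x) then 0 else (if does (v ≟ᶠ y) then 0 else t x y)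
  meeting  t x y = (if does (v ≟ᶠ x) then t x y else 0) + (if does (v ≟ᶠ y) then t x y else 0)

  avoiding+meeting : ∀ t → t v v ≡ 0 → ∀ x y → t x y ≡ avoiding t x y + meeting t x y
  avoiding+meeting t tvv x y = split (v ≟ᶠ x) (v ≟ᶠ y)
    where
    split : (v≟x : Dec (v ≡ x)) (v≟y : Dec (v ≡ y)) →
      t x y ≡ (if does v≟x then 0 else (if does v≟y then 0 else t x y))
            + ((if does v≟x then t x y else 0) + (if does v≟y then t x y else 0))
    split (yes refl) (yes refl) rewrite tvv = refl
    split (yes refl) (no  _)    = sym (+-identityʳ (t x y))
    split (no  _)    (yes refl) = refl
    split (no  _)    (no  _)    = sym (+-identityʳ (t x y))

  ∑∑-meeting : ∀ t → ∑∑ (meeting t) ≡ ∑ (λ u → t v u + t u v) all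
  ∑∑-meeting t = begin
    ∑ (λ x → ∑ (λ y → row x y + column x y) all) all
      ≡⟨ ∑-cong all (λ _ → ∑-+ all) ⟩
    ∑ (λ x → ∑ (row x) all + ∑ (column x) all) all
      ≡⟨ ∑-+ all ⟩
    ∑ (λ x → ∑ (row x) all) all + ∑ (λ x → ∑ (column x) all) all
      ≡⟨ cong₂ _+_ (trans (∑-cong all (λ {x} _ → ∑-if (does (v ≟ᶠ x)) (t x) all))
                          (pick (λ x → ∑ (t x) all)))
                   (∑-cong all (λ {x} _ → pick (t x))) ⟩
    ∑ (t v) all + ∑ (λ u → t u v) all
      ≡⟨ ∑-+ all ⟨
    ∑ (λ u → t v u + t u v) all ∎
    where
    open ≡-Reasoning
    row column : Fin n → Fin n → ℕ
    row    x y = if does (v ≟ᶠ x) then t x y else 0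
    column x y = if does (v ≟ᶠ y) then t x y else 0
    pick : ∀ g → ∑ (λ x → if does (v ≟ᶠ x) then g x else 0) all ≡ g v
    pick g = ∑-select _≟ᶠ_ g v (∈-allFin v) (allFin⁺ n)

  ∑∑-split : ∀ t → t v v ≡ 0 →
    ∑∑ t ≡ ∑∑ (avoiding t) + ∑ (λ u → t v u + t u v) all
  ∑∑-split t tvv = begin
    ∑∑ t
      ≡⟨ ∑-cong all (λ {x} _ → ∑-cong all (λ {y} _ → avoiding+meeting t tvv x y)) ⟩
    ∑ (λ x → ∑ (λ y → avoiding t x y + meeting t x y) all) all
      ≡⟨ ∑-cong all (λ _ → ∑-+ all) ⟩
    ∑ (λ x → ∑ (avoiding t x) all + ∑ (meeting t x) all) all
      ≡⟨ ∑-+ all ⟩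
    ∑∑ (avoiding t) + ∑∑ (meeting t)
      ≡⟨ cong (∑∑ (avoiding t) +_) (∑∑-meeting t) ⟩
    ∑∑ (avoiding t) + ∑ (λ u → t v u + t u v) all ∎
    where open ≡-Reasoning

module _ {n} (G : Graph n) where

  private
    all : List (Fin n)
    all = allFin n

  monoPair : Colouring n → Fin n → Fin n → ℕ
  monoPair χ u v =
    if does (adj G u v Bool.≟ true)
    then (if does (χ u ≟ χ v) then 𝟙 (u <? v) else 0)
    else 0

  monoEdges≡∑monoPair : ∀ χ → monoEdges G χ ≡ ∑∑ (monoPair χ)
  monoEdges≡∑monoPair χ =
    trans (length-filter≡∑ ordered mono)
   (trans (∑-filter sameColour _ adjacent)
   (trans (∑-filter edge _ pairs)
          (∑-cartesianProduct _ all all)))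
    where
    edge : (e : Fin n × Fin n) → Dec (adj G (proj₁ e) (proj₂ e) ≡ true)
    edge e = adj G (proj₁ e) (proj₂ e) Bool.≟ true
    sameColour : (e : Fin n × Fin n) → Dec (χ (proj₁ e) ≡ χ (proj₂ e))
    sameColour e = χ (proj₁ e) ≟ χ (proj₂ e)
    ordered : (e : Fin n × Fin n) → Dec (proj₁ e < proj₂ e)
    ordered e = proj₁ e <? proj₂ e
    pairs adjacent mono : List (Fin n × Fin n)
    pairs    = cartesianProduct all all
    adjacent = filter edge pairs
    mono     = filter sameColour adjacent

  monoPair-loop : ∀ χ v → monoPair χ v v ≡ 0
  monoPair-loop χ v rewrite irrefl G v = refl

  adjacent⇒≢ : ∀ {u v} → adj G u v ≡ true → u ≢ v
  adjacent⇒≢ {u} uv refl with trans (sym uv) (irrefl G u)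
  ... | ()

  monoPair-+-flip : ∀ χ v u → monoPair χ v u + monoPair χ u v ≡
    (if does (adj G v u Bool.≟ true) then 𝟙 (χ u ≟ χ v) else 0)
  monoPair-+-flip χ v u
    rewrite Graph.sym G u v | does-⇔ (mk⇔ sym sym) (χ v ≟ χ u) (χ u ≟ χ v)
    with adj G v u in vu | does (χ u ≟ χ v)
  ... | false | _     = refl
  ... | true  | false = refl
  ... | true  | true  = <?-+->?≡1 (adjacent⇒≢ vu)

  nbrsColoured≡∑ : ∀ χ v c →
    nbrsColoured G χ v c ≡ ∑ (λ u → 𝟙 (χ u ≟ c)) (neighbours G v)
  nbrsColoured≡∑ χ v c = length-filter≡∑ (λ u → χ u ≟ c) (neighbours G v)

  monoEdges-split : ∀ χ v → monoEdges G χ ≡ ∑∑ (avoiding v (monoPair χ)) + defect G χ v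
  monoEdges-split χ v = begin
    monoEdges G χ
      ≡⟨ monoEdges≡∑monoPair χ ⟩
    ∑∑ (monoPair χ)
      ≡⟨ ∑∑-split v (monoPair χ) (monoPair-loop χ v) ⟩
    rest + ∑ (λ u → monoPair χ v u + monoPair χ u v) all
      ≡⟨ cong (rest +_) (∑-cong all (λ {u} _ → monoPair-+-flip χ v u)) ⟩
    rest + ∑ (λ u → if does (adj G v u Bool.≟ true) then sameColour u else 0) all
      ≡⟨ cong (rest +_) (∑-filter (λ u → adj G v u Bool.≟ true) sameColour all) ⟨
    rest + ∑ sameColour (neighbours G v)
      ≡⟨ cong (rest +_) (nbrsColoured≡∑ χ v (χ v)) ⟨
    rest + defect G χ v ∎
    where
    open ≡-Reasoning
    rest : ℕ
    rest = ∑∑ (avoiding v (monoPair χ))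
    sameColour : Fin n → ℕ
    sameColour u = 𝟙 (χ u ≟ χ v)

  module _ {ψ φ : Colouring n} (v : Fin n) (agree : ∀ u → u ≢ v → ψ u ≡ φ u) where

    avoiding-cong : ∀ x y → avoiding v (monoPair ψ) x y ≡ avoiding v (monoPair φ) x y
    avoiding-cong x y = split (v ≟ᶠ x) (v ≟ᶠ y)
      where
      split : (v≟x : Dec (v ≡ x)) (v≟y : Dec (v ≡ y)) →
        (if does v≟x then 0 else (if does v≟y then 0 else monoPair ψ x y)) ≡
        (if does v≟x then 0 else (if does v≟y then 0 else monoPair φ x y))
      split (yes _)   _         = refl
      split (no  _)   (yes _)   = refl
      split (no  v≢x) (no  v≢y) rewrite agree x (v≢x ∘ sym) | agree y (v≢y ∘ sym) = refl

    nbrsColoured-cong : ∀ c → nbrsColoured G ψ v c ≡ nbrsColoured G φ v c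
    nbrsColoured-cong c = begin
      nbrsColoured G ψ v c
        ≡⟨ nbrsColoured≡∑ ψ v c ⟩
      ∑ (λ u → 𝟙 (ψ u ≟ c)) (neighbours G v)
        ≡⟨ ∑-cong (neighbours G v) (λ {u} u∈ → cong (λ d → 𝟙 (d ≟ c))
                                                   (agree u (neighbour≢ u∈))) ⟩
      ∑ (λ u → 𝟙 (φ u ≟ c)) (neighbours G v)
        ≡⟨ nbrsColoured≡∑ φ v c ⟨
      nbrsColoured G φ v c ∎
      where
      open ≡-Reasoning
      neighbour≢ : ∀ {u} → u ∈ neighbours G v → u ≢ v
      neighbour≢ u∈ =
        adjacent⇒≢ (proj₂ (∈-filter⁻ (λ u → adj G v u Bool.≟ true) {xs = all} u∈)) ∘ sym

    monoEdges-recolour : monoEdges G ψ + defect G φ v ≡ monoEdges G φ + defect G ψ v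
    monoEdges-recolour = begin
      monoEdges G ψ + defect G φ v
        ≡⟨ cong (_+ defect G φ v) (monoEdges-split ψ v) ⟩
      ∑∑ (avoiding v (monoPair ψ)) + defect G ψ v + defect G φ v
        ≡⟨ xy∙z≈xz∙y _ (defect G ψ v) (defect G φ v) ⟩
      ∑∑ (avoiding v (monoPair ψ)) + defect G φ v + defect G ψ v
        ≡⟨ cong (λ s → s + defect G φ v + defect G ψ v)
                (∑-cong all (λ {x} _ → ∑-cong all (λ {y} _ → avoiding-cong x y))) ⟩
      ∑∑ (avoiding v (monoPair φ)) + defect G φ v + defect G ψ v
        ≡⟨ cong (_+ defect G ψ v) (monoEdges-split φ v) ⟨
      monoEdges G φ + defect G ψ v ∎
      where open ≡-Reasoning

updateAt-IsLColouring : ∀ {n} (L : ListAssignment n) {φ} v {c} →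
  IsLColouring L φ → c ∈ lst L v → IsLColouring L (updateAt φ v (const c))
updateAt-IsLColouring L {φ} v φ-L c∈ u with u ≟ᶠ v
... | yes refl = subst (_∈ lst L u) (sym (updateAt-updates u φ)) c∈
... | no  u≢v  = subst (_∈ lst L u) (sym (updateAt-minimal u v φ u≢v)) (φ-L u)

module _ {n} (G : Graph n) (φ : Colouring n) (v : Fin n) where

  defect-updateAt : ∀ c → defect G (updateAt φ v (const c)) v ≡ nbrsColoured G φ v c
  defect-updateAt c = trans (cong (nbrsColoured G ψ v) (updateAt-updates v φ))
                            (nbrsColoured-cong G v (λ u u≢v → updateAt-minimal u v φ u≢v) c)
    where
    ψ : Colouring n
    ψ = updateAt φ v (const c)

  minimal⇒defect≤nbrsColoured : ∀ L → MinimisesMono G L φ →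
    ∀ {c} → c ∈ lst L v → defect G φ v ≤ nbrsColoured G φ v c
  minimal⇒defect≤nbrsColoured L (φ-L , φ-min) {c} c∈ = +-cancelˡ-≤ (monoEdges G φ) _ _ (begin
    monoEdges G φ + defect G φ v
      ≤⟨ +-monoˡ-≤ (defect G φ v) (φ-min ψ (updateAt-IsLColouring L v φ-L c∈)) ⟩
    monoEdges G ψ + defect G φ v
      ≡⟨ monoEdges-recolour G v (λ u u≢v → updateAt-minimal u v φ u≢v) ⟩
    monoEdges G φ + defect G ψ v
      ≡⟨ cong (monoEdges G φ +_) (defect-updateAt c) ⟩
    monoEdges G φ + nbrsColoured G φ v c ∎)
    where
    open ≤-Reasoning
    ψ : Colouring n
    ψ = updateAt φ v (const c)

  heavy⇒*length≤deg+1 : ∀ k {cs} → Unique cs →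
    (∀ {c} → c ∈ cs → k ≤ nbrsColoured G φ v c + 𝟙 (φ v ≟ c)) →
    k * length cs ≤ deg G v + 1
  heavy⇒*length≤deg+1 k {cs} cs! heavy = begin
    k * length cs
      ≡⟨ ∑-const k cs ⟨
    ∑ (const k) cs
      ≤⟨ ∑-mono cs heavy ⟩
    ∑ (λ c → nbrsColoured G φ v c + 𝟙 (φ v ≟ c)) cs
      ≡⟨ ∑-+ cs ⟩
    ∑ (nbrsColoured G φ v) cs + ∑ (λ c → 𝟙 (φ v ≟ c)) cs
      ≤⟨ +-mono-≤ (∑-count≤length φ (neighbours G v) cs!)
                  (∑-select-≤ _≟_ (const 1) (φ v) cs!) ⟩
    deg G v + 1 ∎
    where open ≤-Reasoning

lemma16 : ∀ {n} (G : Graph n) (L : ListAssignment n) (φ : Colouring n) →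
          (∀ v → deg G v + 2 ≤ 3 * ∣L∣ L v) →
          MinimisesMono G L φ →
          HasDefect G φ 2 ×
          (∀ v → defect G φ v ≡ 2 →
            Σ Colour (λ β → β ∈ lst L v × β ≢ φ v × nbrsColoured G φ v β ≤ 2))
lemma16 G L φ deg+2≤3∣L∣ φ-min = defect≤2 , spareColour
  where
  notHeavy : ∀ v → ¬ (∀ {c} → c ∈ lst L v → 3 ≤ nbrsColoured G φ v c + 𝟙 (φ v ≟ c))
  notHeavy v heavy
    with +-cancelˡ-≤ (deg G v) 2 1
           (≤-trans (deg+2≤3∣L∣ v) (heavy⇒*length≤deg+1 G φ v 3 (unique L v) heavy))
  ... | s≤s ()

  defect≤2 : HasDefect G φ 2
  defect≤2 v with defect G φ v ≤? 2
  ... | yes d≤2 = d≤2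
  ... | no  d≰2 = ⊥-elim (notHeavy v λ c∈ →
    ≤-trans (≰⇒> d≰2)
            (≤-trans (minimal⇒defect≤nbrsColoured G φ v L φ-min c∈) (m≤m+n _ _)))

  spareColour : ∀ v → defect G φ v ≡ 2 →
    Σ Colour (λ β → β ∈ lst L v × β ≢ φ v × nbrsColoured G φ v β ≤ 2)
  spareColour v d≡2
    with any? (λ β → ¬? (β ≟ φ v) ×-dec (nbrsColoured G φ v β ≤? 2)) (lst L v)
  ... | yes spare = let β , β∈ , β≢φv , β≤2 = find spare in β , β∈ , β≢φv , β≤2
  ... | no  none  = ⊥-elim (notHeavy v heavy)
    where
    heavy : ∀ {c} → c ∈ lst L v → 3 ≤ nbrsColoured G φ v c + 𝟙 (φ v ≟ c)
    heavy {c} c∈ = byColour (φ v ≟ c)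
      where
      byColour : (φv≟c : Dec (φ v ≡ c)) → 3 ≤ nbrsColoured G φ v c + 𝟙 φv≟c
      byColour (yes refl) = ≤-reflexive (cong (_+ 1) (sym d≡2))
      byColour (no  φv≢c) =
        ≤-trans (≰⇒> (λ c≤2 → none (lose c∈ (φv≢c ∘ sym , c≤2)))) (m≤m+n _ _)
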